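{- Let $\Sigma$ be a set of unary predicates and let $\mathfrak{A}$ be any structure interpreting $\Sigma\cup\{\mathfrak{t}\}$ with $\mathfrak{t}^{\mathfrak{A}}$ transitive. Then the certificate of $\mathfrak{A}$, $C(\mathfrak{A})$, is a certificate.
   Context: A 1-type over $\Sigma$ is a maximal consistent conjunction of literals $\pm p(x)$, $p\in\Sigma$; $\mathrm{tp}^{\mathfrak{A}}[a]$ is the 1-type realized by $a$. A super-type is a pair $\langle\pi,\Pi\rangle$ with $\pi$ a 1-type and $\Pi$ a set of 1-types; the super-type of $a$ in $\mathfrak{A}$ is $\mathrm{stp}^{\mathfrak{A}}[a]=\langle \mathrm{tp}^{\mathfrak{A}}[a],\{\mathrm{tp}^{\mathfrak{A}}[b] : \mathfrak{A}\models\mathfrak{t}[a,b]\}\rangle$. For a set $S$ of super-types, $\mathrm{tp}(S)=\{\pi : \langle\pi,\Pi\rangle\in S \text{ for some } \Pi\}$. A certificate is a pair $(S,\ll)$ with $S$ a set of super-types and $\ll$ a transitive relation on $\mathrm{tp}(S)$ such that (C1) if $\langle\pi,\Pi\rangle\in S$ and $\pi'\in\Pi$, then there is $\langle\pi',\Pi'\rangle\in S$ with $\Pi'\subseteq\Pi$; (C2) if $\pi\ll\pi'$, $\langle\pi,\Pi\rangle\in S$ and $\langle\pi',\Pi'\rangle\in S$, then $\{\pi'\}\cup\Pi'\subseteq\Pi$. The certificate of $\mathfrak{A}$, $C(\mathfrak{A})$, is the pair $(S,\ll)$ where $S=\{\mathrm{stp}^{\mathfrak{A}}[a]: a\in A\}$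 and $\pi\ll\pi'$ iff $\pi,\pi'$ are realized in $\mathfrak{A}$ and $\mathfrak{A}\models\forall x(\pi\to\forall y(\pi'(y)\to\mathfrak{t}(x,y)))$. -}

module Defs where

open import Level using (Level; suc; zero)
open import Data.Nat using (ℕ)
open import Data.Fin using (Fin)
open import Data.Bool using (Bool)
open import Data.Vec using (Vec; tabulate)
open import Data.Product using (Σ; ∃; _×_; _,_)
open import Relation.Binary.PropositionalEquality using (_≡_)

-- Σ = {p₀,…,p_{k-1}} is represented by Fin k.
-- A 1-type over Σ (maximal consistent conjunction of literals ±p(x))
-- is determined by which predicates are positive: a vector of Booleans.
OneType : ℕ → Set
OneType k = Vec Bool k

TypeSet : ℕ → Set₁
TypeSet k = OneType k → Set

-- A set S of super-types ⟨π , Π⟩, as a predicate: S π Π means ⟨π,Π⟩ ∈ S.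
SuperTypeSet : ℕ → Set₁
SuperTypeSet k = OneType k → TypeSet k → Set

record Structure (k : ℕ) : Set₁ where
  field
    Carrier : Set
    pred    : Fin k → Carrier → Bool
    t       : Carrier → Carrier → Set

module _ {k : ℕ} (𝔄 : Structure k) where
  open Structure 𝔄

  IsTransitiveT : Set
  IsTransitiveT = ∀ a b c → t a b → t b c → t a c

  tp : Carrier → OneType k
  tp a = tabulate (λ i → pred i a)

  succTypes : Carrier → TypeSet k
  succTypes a σ = ∃ λ b → t a b × tp b ≡ σ

  -- S = { stp^𝔄[a] : a ∈ A }.  Sets of 1-types are predicates, so equality
  -- of the second component is extensional (same members).
  stpSet : SuperTypeSet k
  stpSet π Π = ∃ λ a → (π ≡ tp a) × (∀ σ → (Π σ → succTypes a σ) × (succTypes a σ → Π σ))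

  realized : OneType k → Set
  realized π = ∃ λ a → tp a ≡ π

  ≪𝔄 : OneType k → OneType k → Set
  ≪𝔄 π π' = realized π × realized π' ×
            (∀ a b → tp a ≡ π → tp b ≡ π' → t a b)

tpOf : {k : ℕ} → SuperTypeSet k → OneType k → Set₁
tpOf {k} S π = Σ (TypeSet k) (λ Π → S π Π)

_⊆_ : {k : ℕ} → TypeSet k → TypeSet k → Set
Π₁ ⊆ Π₂ = ∀ σ → Π₁ σ → Π₂ σ

record IsCertificate {k : ℕ} (S : SuperTypeSet k) (_≪_ : OneType k → OneType k → Set) : Set₁ where
  field
    onTpS : ∀ π π' → π ≪ π' → tpOf S π × tpOf S π'
    trans : ∀ π π' π'' → π ≪ π' → π' ≪ π'' → π ≪ π''
    C1    : ∀ π Π → S π Π → ∀ π' → Π π' →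
            Σ (TypeSet k) (λ Π' → S π' Π' × (Π' ⊆ Π))
    C2    : ∀ π π' Π Π' → π ≪ π' → S π Π → S π' Π' →
            Π π' × (Π' ⊆ Π)

-- Every super-type in C(𝔄) is realized by some a, and its set Π is the set of
-- types of t-successors of a.  Transitivity of t makes these successor sets
-- shrink along t, which gives (C1) and (C2), and it makes ≪ transitive.
module Submission where

open import Defs
open import Data.Nat using (ℕ)
open import Data.Product using (Σ; _×_; _,_; proj₁; proj₂)
open import Function using (id)
open import Relation.Binary.PropositionalEquality using (refl; sym)

module _ {k : ℕ} (𝔄 : Structure k) where
  open Structure 𝔄

  stpSet-stp : ∀ a → stpSet 𝔄 (tp 𝔄 a) (succTypes 𝔄 a)
  stpSet-stp a = a , refl , λ _ → id , id

  realized⇒tpOf-stpSet : ∀ {π} → realized 𝔄 π → tpOf (stpSet 𝔄) π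
  realized⇒tpOf-stpSet (a , refl) = succTypes 𝔄 a , stpSet-stp a

  succTypes-antitone : IsTransitiveT 𝔄 → ∀ {a b} → t a b → succTypes 𝔄 b ⊆ succTypes 𝔄 a
  succTypes-antitone trans-t tab _ (c , tbc , tc≡σ) = c , trans-t _ _ c tab tbc , tc≡σ

  ≪𝔄-trans : IsTransitiveT 𝔄 → ∀ {π π' π''} → ≪𝔄 𝔄 π π' → ≪𝔄 𝔄 π' π'' → ≪𝔄 𝔄 π π''
  ≪𝔄-trans trans-t (rπ , (b , tb≡π') , ππ') (_ , rπ'' , π'π'') =
    rπ , rπ'' , λ a c ta≡π tc≡π'' →
      trans-t a b c (ππ' a b ta≡π tb≡π') (π'π'' b c tb≡π' tc≡π'')

  C1-stpSet : IsTransitiveT 𝔄 → ∀ {π Π} → stpSet 𝔄 π Π → ∀ {π'} → Π π' →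
              Σ (TypeSet k) (λ Π' → stpSet 𝔄 π' Π' × (Π' ⊆ Π))
  C1-stpSet trans-t (a , _ , Π⇔succ) {π'} π'∈Π with proj₁ (Π⇔succ π') π'∈Π
  ... | b , tab , refl =
    succTypes 𝔄 b , stpSet-stp b ,
    λ σ σ∈succ → proj₂ (Π⇔succ σ) (succTypes-antitone trans-t tab σ σ∈succ)

  C2-stpSet : IsTransitiveT 𝔄 → ∀ {π π' Π Π'} → ≪𝔄 𝔄 π π' →
              stpSet 𝔄 π Π → stpSet 𝔄 π' Π' → Π π' × (Π' ⊆ Π)
  C2-stpSet trans-t (_ , _ , ππ') (a , π≡ta , Π⇔succ) (b , π'≡tb , Π'⇔succ) =
    proj₂ (Π⇔succ _) (b , tab , sym π'≡tb) ,
    λ σ σ∈Π' → proj₂ (Π⇔succ σ)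
                 (succTypes-antitone trans-t tab σ (proj₁ (Π'⇔succ σ) σ∈Π'))
    where
    tab : t a b
    tab = ππ' a b (sym π≡ta) (sym π'≡tb)

lemma2 : (k : ℕ) (𝔄 : Structure k) → IsTransitiveT 𝔄 → IsCertificate (stpSet 𝔄) (≪𝔄 𝔄)
lemma2 k 𝔄 trans-t = record
  { onTpS = λ _ _ (rπ , rπ' , _) → realized⇒tpOf-stpSet 𝔄 rπ , realized⇒tpOf-stpSet 𝔄 rπ'
  ; trans = λ _ _ _ → ≪𝔄-trans 𝔄 trans-t
  ; C1    = λ _ _ S∋ _ → C1-stpSet 𝔄 trans-t S∋
  ; C2    = λ _ _ _ _ → C2-stpSet 𝔄 trans-t
  }
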